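{- Let $\alpha,\beta$ be prenamings with $C^+(\alpha)\cap C^+(\beta)=\emptyset$ and $R^+(\alpha)\cap R^+(\beta)=\emptyset$, so that $\alpha\oplus\beta$ is defined. Then (1) $\mathrm{indom}(\alpha)\cup\mathrm{indom}(\beta)=V$, and (2) $\mathrm{indom}(\alpha)\cap\mathrm{indom}(\beta)\subseteq\mathrm{indom}(\alpha\oplus\beta)$.
   Context: $V$ is a countably infinite set of variables. A prenaming is a substitution $\alpha$ mapping variables to variables together with a fixed finite set $C^+(\alpha)\supseteq\mathrm{Dom}(\alpha)=\{x:\alpha(x)\neq x\}$ (relaxed core) on which $\alpha$ is injective; $R^+(\alpha)=\alpha(C^+(\alpha))$; $\mathrm{indom}(\alpha)=V\setminus(R^+(\alpha)\setminus C^+(\alpha))$. The sum $\alpha\oplus\beta$ is the prenaming with relaxed core $C^+(\alpha)\cup C^+(\beta)$ agreeing with $\alpha$ on $C^+(\alpha)$, with $\beta$ on $C^+(\beta)$, identity elsewhere. -}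

module Defs where

open import Data.Nat using (ℕ)
open import Data.Nat.Properties using (_≟_)
open import Data.List using (List; _++_)
open import Data.List.Membership.Propositional using (_∈_)
open import Data.List.Membership.Propositional.Properties using (∈-++⁺ˡ; ∈-++⁺ʳ; ∈-++⁻)
open import Data.List.Membership.DecPropositional _≟_ using (_∈?_)
open import Data.Product using (Σ; ∃; _×_; _,_)
open import Data.Sum using (_⊎_; inj₁; inj₂)
open import Data.Empty using (⊥; ⊥-elim)
open import Relation.Nullary using (¬_; yes; no)
open import Relation.Binary.PropositionalEquality using (_≡_; _≢_; refl; sym; trans)

Var : Set
Var = ℕ

Subset : Set₁
Subset = Var → Set

-- A prenaming: a variable-to-variable map α with a finite relaxed core
-- C⁺(α) (a list) containing Dom(α) = {x | α x ≠ x}, on which α is injective.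
record Prenaming : Set where
  field
    map       : Var → Var
    core      : List Var
    dom⊆core  : ∀ x → map x ≢ x → x ∈ core
    injective : ∀ {x y} → x ∈ core → y ∈ core → map x ≡ map y → x ≡ y
open Prenaming public

C⁺ : Prenaming → Subset
C⁺ α x = x ∈ core α

R⁺ : Prenaming → Subset
R⁺ α y = Σ Var λ x → x ∈ core α × map α x ≡ y

indom : Prenaming → Subset
indom α y = ¬ (R⁺ α y × ¬ C⁺ α y)

_∩_ : Subset → Subset → Subset
(A ∩ B) x = A x × B x

_∪_ : Subset → Subset → Subset
(A ∪ B) x = A x ⊎ B x

_⊆_ : Subset → Subset → Set
A ⊆ B = ∀ x → A x → B x

_≐_ : Subset → Subset → Set
A ≐ B = A ⊆ B × B ⊆ A

Full : Subset
Full _ = Data.Unit.⊤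
  where import Data.Unit

Disjoint : Subset → Subset → Set
Disjoint A B = ∀ x → A x → B x → ⊥

⊕-map : Prenaming → Prenaming → Var → Var
⊕-map α β x with x ∈? core α
... | yes _ = map α x
... | no _ with x ∈? core β
...   | yes _ = map β x
...   | no _  = x

private
  ⊕-onα : ∀ α β {x} → x ∈ core α → ⊕-map α β x ≡ map α x
  ⊕-onα α β {x} p with x ∈? core α
  ... | yes _ = refl
  ... | no ¬p = ⊥-elim (¬p p)

  ⊕-onβ : ∀ α β → Disjoint (C⁺ α) (C⁺ β) → ∀ {x} → x ∈ core β → ⊕-map α β x ≡ map β x
  ⊕-onβ α β dC {x} q with x ∈? core α
  ... | yes p = ⊥-elim (dC x p q)
  ... | no _ with x ∈? core β
  ...   | yes _ = refl
  ...   | no ¬q = ⊥-elim (¬q q)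

  ⊕-dom : ∀ α β x → ⊕-map α β x ≢ x → x ∈ (core α ++ core β)
  ⊕-dom α β x ne with x ∈? core α
  ... | yes p = ∈-++⁺ˡ p
  ... | no _ with x ∈? core β
  ...   | yes q = ∈-++⁺ʳ (core α) q
  ...   | no _  = ⊥-elim (ne refl)

  ⊕-inj : ∀ α β → Disjoint (C⁺ α) (C⁺ β) → Disjoint (R⁺ α) (R⁺ β) →
          ∀ {x y} → x ∈ (core α ++ core β) → y ∈ (core α ++ core β) →
          ⊕-map α β x ≡ ⊕-map α β y → x ≡ y
  ⊕-inj α β dC dR {x} {y} px py e with ∈-++⁻ (core α) px | ∈-++⁻ (core α) py
  ... | inj₁ p | inj₁ q = injective α p q (trans (sym (⊕-onα α β p)) (trans e (⊕-onα α β q)))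
  ... | inj₂ p | inj₂ q = injective β p q (trans (sym (⊕-onβ α β dC p)) (trans e (⊕-onβ α β dC q)))
  ... | inj₁ p | inj₂ q = ⊥-elim (dR (map α x) (x , p , refl)
          (y , q , sym (trans (sym (⊕-onα α β p)) (trans e (⊕-onβ α β dC q)))))
  ... | inj₂ p | inj₁ q = ⊥-elim (dR (map α y) (y , q , refl)
          (x , p , trans (sym (⊕-onβ α β dC p)) (trans e (⊕-onα α β q))))

_⊕_⟨_,_⟩ : (α β : Prenaming) → Disjoint (C⁺ α) (C⁺ β) → Disjoint (R⁺ α) (R⁺ β) → Prenaming
α ⊕ β ⟨ dC , dR ⟩ = record
  { map       = ⊕-map α β
  ; core      = core α ++ core β
  ; dom⊆core  = ⊕-dom α β
  ; injective = ⊕-inj α β dC dR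
  }

module Submission where

-- Membership in indom(α) only fails at a variable of
-- R⁺(α) \ C⁺(α), so a variable outside R⁺(α) always lies in indom(α).
--   (1) Since R⁺(α) = α(C⁺(α)) is the image of a finite list, membership in
--       it is decidable.  If y ∉ R⁺(α) then y ∈ indom(α); if y ∈ R⁺(α) then
--       y ∉ R⁺(β) by disjointness of the ranges, hence y ∈ indom(β).
--   (2) α ⊕ β agrees with α on C⁺(α) and with β on C⁺(β), so
--       R⁺(α ⊕ β) ⊆ R⁺(α) ∪ R⁺(β), while C⁺(α), C⁺(β) ⊆ C⁺(α ⊕ β).
--       A witness y ∈ R⁺(α ⊕ β) \ C⁺(α ⊕ β) therefore yields a witness in
--       R⁺(α) \ C⁺(α) or in R⁺(β) \ C⁺(β), contradicting y ∈ indom(α) ∩ indom(β).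

open import Defs
open import Data.Product using (_×_; _,_)
open import Data.Sum using (_⊎_; inj₁; inj₂; [_,_])
open import Data.Empty using (⊥-elim)
open import Data.Nat.Properties using (_≟_)
import Data.List as List
open import Data.List.Membership.Propositional using (_∈_)
open import Data.List.Membership.Propositional.Properties
  using (∈-++⁺ˡ; ∈-++⁺ʳ; ∈-++⁻; ∈-map⁺; ∈-map⁻)
open import Data.List.Membership.DecPropositional _≟_ using (_∈?_)
open import Relation.Nullary using (¬_; Dec; yes; no)
open import Relation.Nullary.Decidable using (map′)
open import Relation.Binary.PropositionalEquality using (_≡_; refl; sym; trans)

R⁺-dec : ∀ α y → Dec (R⁺ α y)
R⁺-dec α y = map′ fromImage toImage (y ∈? List.map (map α) (core α))
  where
  fromImage : y ∈ List.map (map α) (core α) → R⁺ α y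
  fromImage m with ∈-map⁻ (map α) m
  ... | x , x∈C , y≡αx = x , x∈C , sym y≡αx

  toImage : R⁺ α y → y ∈ List.map (map α) (core α)
  toImage (x , x∈C , refl) = ∈-map⁺ (map α) x∈C

∉R⁺⇒indom : ∀ α {y} → ¬ R⁺ α y → indom α y
∉R⁺⇒indom α y∉R (y∈R , _) = y∉R y∈R

indom-cover : ∀ α β → Disjoint (R⁺ α) (R⁺ β) → ∀ y → (indom α ∪ indom β) y
indom-cover α β dR y with R⁺-dec α y
... | no  y∉Rα = inj₁ (∉R⁺⇒indom α y∉Rα)
... | yes y∈Rα = inj₂ (∉R⁺⇒indom β (dR y y∈Rα))

⊕-agrees-α : ∀ α β {x} → x ∈ core α → ⊕-map α β x ≡ map α x
⊕-agrees-α α β {x} x∈Cα with x ∈? core α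
... | yes _    = refl
... | no x∉Cα = ⊥-elim (x∉Cα x∈Cα)

⊕-agrees-β : ∀ α β → Disjoint (C⁺ α) (C⁺ β) →
             ∀ {x} → x ∈ core β → ⊕-map α β x ≡ map β x
⊕-agrees-β α β dC {x} x∈Cβ with x ∈? core α
... | yes x∈Cα = ⊥-elim (dC x x∈Cα x∈Cβ)
... | no _ with x ∈? core β
...   | yes _    = refl
...   | no x∉Cβ = ⊥-elim (x∉Cβ x∈Cβ)

module _ (α β : Prenaming) (dC : Disjoint (C⁺ α) (C⁺ β))
         (dR : Disjoint (R⁺ α) (R⁺ β)) where

  private
    γ : Prenaming
    γ = α ⊕ β ⟨ dC , dR ⟩

  R⁺-⊕-split : ∀ {y} → R⁺ γ y → R⁺ α y ⊎ R⁺ β y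
  R⁺-⊕-split (x , x∈C , γx≡y) with ∈-++⁻ (core α) x∈C
  ... | inj₁ x∈Cα = inj₁ (x , x∈Cα , trans (sym (⊕-agrees-α α β x∈Cα)) γx≡y)
  ... | inj₂ x∈Cβ = inj₂ (x , x∈Cβ , trans (sym (⊕-agrees-β α β dC x∈Cβ)) γx≡y)

  -- Part (2): a witness against y ∈ indom(α ⊕ β) is one against y ∈ indom(α)
  -- or against y ∈ indom(β), since both cores are contained in C⁺(α ⊕ β).
  indom-⊕ : (indom α ∩ indom β) ⊆ indom γ
  indom-⊕ y (y∈Iα , y∈Iβ) (y∈Rγ , y∉Cγ) =
    [ (λ y∈Rα → y∈Iα (y∈Rα , λ y∈Cα → y∉Cγ (∈-++⁺ˡ y∈Cα)))
    , (λ y∈Rβ → y∈Iβ (y∈Rβ , λ y∈Cβ → y∉Cγ (∈-++⁺ʳ (core α) y∈Cβ)))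
    ] (R⁺-⊕-split y∈Rγ)

mainTheorem16 : (α β : Prenaming)
    → (dC : Disjoint (C⁺ α) (C⁺ β))
    → (dR : Disjoint (R⁺ α) (R⁺ β))
    → ((indom α ∪ indom β) ≐ Full)
      × ((indom α ∩ indom β) ⊆ indom (α ⊕ β ⟨ dC , dR ⟩))
mainTheorem16 α β dC dR =
  ((λ _ _ → _) , λ y _ → indom-cover α β dR y) , indom-⊕ α β dC dR
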